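{- Let $H$ be a bipartite graph and let $\mathcal{H}$ be a two-lift of $H$. If $\mathrm{ex}(n,H) = O(n^{\gamma})$ for some $\gamma>0$, then $\mathrm{ex}(n,\mathcal{H}) = O\!\left(n^{\frac{\gamma+4}{2}}\right)$.
   Context: For an $r$-graph $F$ (a pair $(V,E)$ with $E$ a set of $r$-element subsets of $V$; graphs are $2$-graphs), $\mathrm{ex}(n,F)$ denotes the largest number of edges in an $n$-vertex $r$-graph containing no subgraph isomorphic to $F$. For a $3$-graph and a vertex $x$, the link graph $L(x)$ is the graph without isolated vertices whose edges are the pairs $yz$ such that $xyz$ is an edge. For a bipartite graph $H$, a two-lift of $H$ is the $3$-graph with vertex set $\{a,b\}\cup V(H)$, where $a\neq b$ and $a,b\notin V(H)$, in which every edge contains exactly one of $a$, $b$, and $L(a)=L(b)=H$. -}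

module Defs where

open import Data.Nat using (ℕ; zero; suc; _+_; _*_; _^_; _≤_)
open import Data.Bool using (Bool; true; false; if_then_else_; _xor_; _∧_)
open import Data.Fin using (Fin; _≟_)
open import Data.Fin.Subset using (Subset; ∣_∣; _∈_)
open import Data.Fin.Subset.Properties using (_∈?_)
open import Data.Fin.Properties using (any?)
open import Data.Vec using (Vec; []; _∷_; tabulate)
open import Data.List using (List; []; _∷_; map; _++_)
open import Data.Nat.ListAction using (sum)
open import Data.Product using (Σ; _×_; _,_; ∃; ∃-syntax)
open import Data.Integer using () renaming (∣_∣ to absℤ)
open import Data.Rational using (ℚ; ↥_; ↧ₙ_; 0ℚ) renaming (_<_ to _<ℚ_; _≤_ to _≤ℚ_)
open import Function.Definitions using (Injective)
open import Relation.Nullary using (¬_; does)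
open import Relation.Nullary.Decidable using (_×-dec_)
open import Relation.Binary.PropositionalEquality using (_≡_; _≢_; refl)

record RGraph (r n : ℕ) : Set where
  field
    edge    : Subset n → Bool
    uniform : ∀ s → edge s ≡ true → ∣ s ∣ ≡ r
open RGraph public

allSubsets : (n : ℕ) → List (Subset n)
allSubsets zero    = [] ∷ []
allSubsets (suc n) = map (true ∷_) (allSubsets n) ++ map (false ∷_) (allSubsets n)

numEdges : ∀ {r n} → RGraph r n → ℕ
numEdges {r} {n} G = sum (map (λ s → if edge G s then 1 else 0) (allSubsets n))

image : ∀ {m n} → (Fin m → Fin n) → Subset m → Subset n
image φ s = tabulate (λ j → does (any? (λ i → (i ∈? s) ×-dec (φ i ≟ j))))

Contains : ∀ {r m n} → RGraph r n → RGraph r m → Set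
Contains {r} {m} {n} G F =
  Σ (Fin m → Fin n) λ φ → Injective _≡_ _≡_ φ ×
    (∀ s → edge F s ≡ true → edge G (image φ s) ≡ true)

Bipartite : ∀ {m} → RGraph 2 m → Set
Bipartite {m} H = Σ (Fin m → Bool) λ c →
  ∀ s → edge H s ≡ true → ∀ i j → i ∈ s → j ∈ s → i ≢ j → c i ≢ c j

-- The two-lift of H: vertex set Fin (2 + m), where vertex 0 is a, vertex 1
-- is b and vertex (2 + u) is the vertex u of H.  Edges are {a} ∪ e and
-- {b} ∪ e for e ∈ E(H); so every edge contains exactly one of a, b and
-- L(a) = L(b) = H.
twoLiftEdge : ∀ {m} → RGraph 2 m → Subset (suc (suc m)) → Bool
twoLiftEdge H (x ∷ y ∷ t) = (x xor y) ∧ edge H t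

twoLiftUniform : ∀ {m} (H : RGraph 2 m) s → twoLiftEdge H s ≡ true → ∣ s ∣ ≡ 3
twoLiftUniform H (true ∷ false ∷ t) e with uniform H t e
... | p rewrite p = refl
twoLiftUniform H (false ∷ true ∷ t) e with uniform H t e
... | p rewrite p = refl
twoLiftUniform H (true ∷ true ∷ t) ()
twoLiftUniform H (false ∷ false ∷ t) ()

twoLift : ∀ {m} → RGraph 2 m → RGraph 3 (suc (suc m))
twoLift H = record { edge = twoLiftEdge H ; uniform = twoLiftUniform H }

-- A positive real γ, represented (Dedekind-style) by its upper cut
-- U = { r ∈ ℚ : γ < r }.
record PosReal : Set₁ where
  field
    U         : ℚ → Set
    upward    : ∀ {r s} → U r → r ≤ℚ s → U s
    rounded   : ∀ {r} → U r → ∃[ s ] (s <ℚ r × U s)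
    inhabited : ∃[ r ] U r
    positive  : ∃[ r ] (0ℚ <ℚ r × ¬ U r)
open PosReal public

-- ex(n, F) = O(n^β) where β is the real whose upper cut is
-- { f r : r ∈ U γ }:  there is a constant C such that for all n, every
-- F-free r-graph G on n vertices has e(G) ≤ C · n^(p/q) for every rational
-- p/q = f r with r ∈ U γ, i.e. e(G)^q ≤ C^q · n^p.
-- (Since n^β = inf { n^ρ : ρ > β rational } for n ≥ 1, this is exactly
-- ex(n,F) ≤ C · n^β for all n.)
ExBigO : ∀ {k m} → RGraph k m → PosReal → (ℚ → ℚ) → Set
ExBigO {k} F γ f = ∃[ C ] ∀ r → U γ r → ∀ n (G : RGraph k n) → ¬ Contains G F →
  numEdges G ^ ↧ₙ (f r) ≤ C ^ ↧ₙ (f r) * n ^ absℤ (↥ (f r))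

-- Double counting through codegrees.  Let G be an n-vertex 3-graph with E edges and no two-lift of H,
-- and for a pair s of vertices let d(s) be its codegree.  Then Σ_s d(s) = 3E and Σ_s d(s)² = Σ_{a,b} |L(a) ∩ L(b)|.
-- For a ≠ b the common link L(a) ∩ L(b), restricted to the other n - 2 vertices, is H-free, since a copy of H
-- in it together with a and b is a two-lift of H; so it has at most ex(n, H) = O(n^γ) edges, while the diagonal
-- terms sum to 3E.  Cauchy–Schwarz over the at most n² pairs gives 9E² ≤ n²(3E + n² ex(n, H)), hence
-- E² = O(n^(4+γ)).
module Submission where

module TwoLiftExtremal where

  open import Algebra.Properties.Semiring.Sum as Σ using ()
  open import Data.Bool using (Bool; true; false; not; _∧_; if_then_else_)
  open import Data.Bool.Properties using (∧-zeroʳ; ∧-idem; ∧-conicalˡ; ∧-conicalʳ; T-≡)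
  open import Data.Fin using (Fin; zero; suc; punchIn; punchOut; _≟_)
  open import Data.Fin.Properties using (any?; punchInᵢ≢i; punchIn-injective; punchIn-punchOut)
  open import Data.Fin.Subset using (Subset; ∣_∣; _∈_)
  open import Data.Fin.Subset.Properties using (_∈?_; ⊆-antisym)
  open import Data.Integer as ℤ using (+[1+_]; +0; -[1+_]) renaming (∣_∣ to ∣_∣ℤ)
  open import Data.Integer.Properties using (abs-◃)
  open import Data.List using (map; _++_)
  open import Data.List.Properties using (map-++; map-∘)
  open import Data.Nat using (ℕ; zero; suc; _+_; _*_; _^_; _≤_; _≡ᵇ_; _⊔_; _≤?_; z≤n; NonZero)
  open import Data.Nat.ListAction using () renaming (sum to sumˡ)
  open import Data.Nat.ListAction.Properties using (sum-++)
  open import Data.Nat.Properties hiding (_≟_)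
  open import Data.Nat.Solver using (module +-*-Solver)
  open import Data.Product using (_,_; _×_; ∃)
  open import Data.Rational using (mkℚ; ↥_; ↧ₙ_; 0ℚ; ½; _/_)
    renaming (_+_ to _+ℚ_; _*_ to _*ℚ_; _<_ to _<ℚ_; _≤?_ to _≤ℚ?_)
  open import Data.Rational.Base using () renaming (positive to ℚ-positive)
  open import Data.Rational.Properties using (toℚᵘ-homo-+; toℚᵘ-homo-*) renaming (≰⇒> to ≰⇒>ℚ; <-trans to <ℚ-trans)
  open import Data.Rational.Unnormalised using (*≡*)
  open import Data.Rational.Unnormalised.Properties using (≃-trans; *-congʳ)
  open import Data.Sum using (_⊎_; inj₁; inj₂; [_,_]′)
  open import Data.Vec using (Vec; []; _∷_; lookup; insertAt; _[_]≔_; here; there)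
  open import Data.Vec.Properties using (insertAt-lookup; insertAt-punchIn; lookup∘tabulate; []=⇒lookup; lookup⇒[]=)
  open import Function using (_∘_; _⟨_⟩_)
  open import Function.Bundles using (Equivalence)
  open import Function.Definitions using (Injective)
  open import Relation.Binary.PropositionalEquality
  open import Relation.Nullary using (¬_; yes; no; contradiction)
  open import Relation.Nullary.Decidable using (dec-true; _×-dec_)
  open import Defs

  open import Algebra.Properties.CommutativeSemigroup +-commutativeSemigroup using (interchange)
  open Σ +-*-semiring using (sum-syntax; sum-cong-≗; sum-remove; ∑-distrib-+; *-distribˡ-sum; *-distribʳ-sum)
  open +-*-Solver

  ^-distribʳ-* : ∀ m n k → (m * n) ^ k ≡ m ^ k * n ^ k
  ^-distribʳ-* m n zero    = refl
  ^-distribʳ-* m n (suc k) = begin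
    m * n * (m * n) ^ k       ≡⟨ cong (m * n *_) (^-distribʳ-* m n k) ⟩
    m * n * (m ^ k * n ^ k)   ≡⟨ [m*n]*[o*p]≡[m*o]*[n*p] m n (m ^ k) (n ^ k) ⟩
    m * m ^ k * (n * n ^ k)   ∎
    where open ≡-Reasoning

  ^-cancelʳ-≤ : ∀ k .{{_ : NonZero k}} {m n} → m ^ k ≤ n ^ k → m ≤ n
  ^-cancelʳ-≤ k mᵏ≤nᵏ = ≮⇒≥ (λ n<m → <⇒≱ (^-monoˡ-< k n<m) mᵏ≤nᵏ)

  4*[m*n]≤[m+n]*[m+n] : ∀ m n → 4 * (m * n) ≤ (m + n) * (m + n)
  4*[m*n]≤[m+n]*[m+n] m n with ≤-total m n
  ... | inj₁ m≤n with m≤n⇒∃[o]m+o≡n m≤n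
  ...   | c , refl = ≤-trans (m≤m+n _ (c * c)) (≤-reflexive
            (solve 2 (λ m c → con 4 :* (m :* (m :+ c)) :+ c :* c := (m :+ (m :+ c)) :* (m :+ (m :+ c))) refl m c))
  4*[m*n]≤[m+n]*[m+n] m n | inj₂ n≤m with m≤n⇒∃[o]m+o≡n n≤m
  ...   | c , refl = ≤-trans (m≤m+n _ (c * c)) (≤-reflexive
            (solve 2 (λ n c → con 4 :* ((n :+ c) :* n) :+ c :* c := ((n :+ c) :+ n) :* ((n :+ c) :+ n)) refl n c))

  m*m≤n*n⇒m≤n : ∀ {m n} → m * m ≤ n * n → m ≤ n
  m*m≤n*n⇒m≤n m²≤n² = ≮⇒≥ (λ n<m → <⇒≱ (*-mono-< n<m n<m) m²≤n²)

  -- The cross term is bounded by AM-GM applied to p s and r q, whose product dominates (x y)².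
  cauchy-schwarz-+ : ∀ {x y p q r s} → x * x ≤ p * q → y * y ≤ r * s →
                     (x + y) * (x + y) ≤ (p + r) * (q + s)
  cauchy-schwarz-+ {x} {y} {p} {q} {r} {s} x²≤pq y²≤rs = begin
    (x + y) * (x + y)               ≡⟨ solve 2 (λ x y → (x :+ y) :* (x :+ y) := x :* x :+ y :* y :+ con 2 :* (x :* y)) refl x y ⟩
    x * x + y * y + 2 * (x * y)     ≤⟨ +-mono-≤ (+-mono-≤ x²≤pq y²≤rs) cross ⟩
    p * q + r * s + (p * s + r * q) ≡⟨ solve 4 (λ p q r s → p :* q :+ r :* s :+ (p :* s :+ r :* q) := (p :+ r) :* (q :+ s)) refl p q r s ⟩
    (p + r) * (q + s)               ∎
    where
    open ≤-Reasoning
    cross : 2 * (x * y) ≤ p * s + r * q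
    cross = m*m≤n*n⇒m≤n (begin
      2 * (x * y) * (2 * (x * y))   ≡⟨ solve 2 (λ x y → con 2 :* (x :* y) :* (con 2 :* (x :* y)) := con 4 :* (x :* x :* (y :* y))) refl x y ⟩
      4 * (x * x * (y * y))         ≤⟨ *-monoʳ-≤ 4 (*-mono-≤ x²≤pq y²≤rs) ⟩
      4 * (p * q * (r * s))         ≡⟨ cong (4 *_) (solve 4 (λ p q r s → p :* q :* (r :* s) := p :* s :* (r :* q)) refl p q r s) ⟩
      4 * (p * s * (r * q))         ≤⟨ 4*[m*n]≤[m+n]*[m+n] (p * s) (r * q) ⟩
      (p * s + r * q) * (p * s + r * q) ∎)

  -- Sums over all subsets

  𝟙 : Bool → ℕ
  𝟙 b = if b then 1 else 0

  𝟙-∧ : ∀ b c → 𝟙 (b ∧ c) ≡ 𝟙 b * 𝟙 c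
  𝟙-∧ true  c = sym (+-identityʳ (𝟙 c))
  𝟙-∧ false c = refl

  𝟙-idem : ∀ b → 𝟙 b * 𝟙 b ≡ 𝟙 b
  𝟙-idem true  = refl
  𝟙-idem false = refl

  ∑ˢ : ∀ n → (Subset n → ℕ) → ℕ
  ∑ˢ zero    w = w []
  ∑ˢ (suc n) w = ∑ˢ n (λ t → w (true ∷ t)) + ∑ˢ n (λ t → w (false ∷ t))

  sumˡ-map-allSubsets : ∀ n w → sumˡ (map w (allSubsets n)) ≡ ∑ˢ n w
  sumˡ-map-allSubsets zero    w = +-identityʳ (w [])
  sumˡ-map-allSubsets (suc n) w = begin
    sumˡ (map w (map (true ∷_) L ++ map (false ∷_) L))
      ≡⟨ cong sumˡ (map-++ w (map (true ∷_) L) _) ⟩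
    sumˡ (map w (map (true ∷_) L) ++ map w (map (false ∷_) L))
      ≡⟨ sum-++ (map w (map (true ∷_) L)) _ ⟩
    sumˡ (map w (map (true ∷_) L)) + sumˡ (map w (map (false ∷_) L))
      ≡⟨ cong₂ _+_ (cong sumˡ (sym (map-∘ L))) (cong sumˡ (sym (map-∘ L))) ⟩
    sumˡ (map (λ t → w (true ∷ t)) L) + sumˡ (map (λ t → w (false ∷ t)) L)
      ≡⟨ cong₂ _+_ (sumˡ-map-allSubsets n _) (sumˡ-map-allSubsets n _) ⟩
    ∑ˢ (suc n) w ∎
    where
    open ≡-Reasoning
    L = allSubsets n

  ∑ˢ-cong : ∀ n {v w} → (∀ s → v s ≡ w s) → ∑ˢ n v ≡ ∑ˢ n w
  ∑ˢ-cong zero    v≗w = v≗w []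
  ∑ˢ-cong (suc n) v≗w = cong₂ _+_ (∑ˢ-cong n (v≗w ∘ (true ∷_))) (∑ˢ-cong n (v≗w ∘ (false ∷_)))

  ∑ˢ-zero : ∀ n → ∑ˢ n (λ _ → 0) ≡ 0
  ∑ˢ-zero zero    = refl
  ∑ˢ-zero (suc n) = cong₂ _+_ (∑ˢ-zero n) (∑ˢ-zero n)

  *-distribˡ-∑ˢ : ∀ n c w → c * ∑ˢ n w ≡ ∑ˢ n (λ s → c * w s)
  *-distribˡ-∑ˢ zero    c w = refl
  *-distribˡ-∑ˢ (suc n) c w = trans (*-distribˡ-+ c (∑ˢ n _) (∑ˢ n _))
    (cong₂ _+_ (*-distribˡ-∑ˢ n c _) (*-distribˡ-∑ˢ n c _))

  ∑ˢ-∑-comm : ∀ n {m} (w : Fin m → Subset n → ℕ) →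
              ∑ˢ n (λ s → ∑[ a < m ] w a s) ≡ ∑[ a < m ] ∑ˢ n (w a)
  ∑ˢ-∑-comm zero    w = refl
  ∑ˢ-∑-comm (suc n) w = trans (cong₂ _+_ (∑ˢ-∑-comm n (λ a t → w a (true ∷ t))) (∑ˢ-∑-comm n (λ a t → w a (false ∷ t))))
    (sym (∑-distrib-+ (λ a → ∑ˢ n (λ t → w a (true ∷ t))) _))

  ∑ˢ-insertAt : ∀ k (i : Fin (suc k)) w →
    ∑ˢ (suc k) w ≡ ∑ˢ k (λ t → w (insertAt t i true)) + ∑ˢ k (λ t → w (insertAt t i false))
  ∑ˢ-insertAt k       zero    w = refl
  ∑ˢ-insertAt (suc k) (suc i) w =
    trans (cong₂ _+_ (∑ˢ-insertAt k i (w ∘ (true ∷_))) (∑ˢ-insertAt k i (w ∘ (false ∷_))))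
          (interchange (half true true) (half true false) (half false true) (half false false))
    where
    half : Bool → Bool → ℕ
    half x y = ∑ˢ k (λ t → w (x ∷ insertAt t i y))

  cauchy-schwarz : ∀ n (f g : Subset n → ℕ) →
    ∑ˢ n (λ s → f s * g s) * ∑ˢ n (λ s → f s * g s) ≤ ∑ˢ n (λ s → f s * f s) * ∑ˢ n (λ s → g s * g s)
  cauchy-schwarz zero    f g = ≤-reflexive ([m*n]*[o*p]≡[m*o]*[n*p] (f []) (g []) (f []) (g []))
  cauchy-schwarz (suc n) f g =
    cauchy-schwarz-+ {fg true} {fg false} {ff true} {gg true} {ff false} {gg false}
      (cauchy-schwarz n (f ∘ (true ∷_)) (g ∘ (true ∷_))) (cauchy-schwarz n (f ∘ (false ∷_)) (g ∘ (false ∷_)))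
    where
    fg ff gg : Bool → ℕ
    fg b = ∑ˢ n (λ t → f (b ∷ t) * g (b ∷ t))
    ff b = ∑ˢ n (λ t → f (b ∷ t) * f (b ∷ t))
    gg b = ∑ˢ n (λ t → g (b ∷ t) * g (b ∷ t))

  ∑ˢ-size≡k-≤-n^k : ∀ n k → ∑ˢ n (λ s → 𝟙 (∣ s ∣ ≡ᵇ k)) ≤ n ^ k
  ∑ˢ-size≡k-≤-n^k zero    zero    = ≤-refl
  ∑ˢ-size≡k-≤-n^k zero    (suc k) = z≤n
  ∑ˢ-size≡k-≤-n^k (suc n) zero    =
    ≤-trans (≤-reflexive (cong (_+ ∑ˢ n (λ t → 𝟙 (∣ t ∣ ≡ᵇ zero))) (∑ˢ-zero n))) (∑ˢ-size≡k-≤-n^k n zero)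
  ∑ˢ-size≡k-≤-n^k (suc n) (suc k) = begin
    ∑ˢ n (λ t → 𝟙 (∣ t ∣ ≡ᵇ k)) + ∑ˢ n (λ t → 𝟙 (∣ t ∣ ≡ᵇ suc k))
      ≤⟨ +-mono-≤ (∑ˢ-size≡k-≤-n^k n k) (∑ˢ-size≡k-≤-n^k n (suc k)) ⟩
    n ^ k + n * n ^ k
      ≤⟨ +-mono-≤ (^-monoˡ-≤ k (n≤1+n n)) (*-monoʳ-≤ n (^-monoˡ-≤ k (n≤1+n n))) ⟩
    suc n ^ k + n * suc n ^ k
      ≡⟨⟩
    suc n ^ suc k ∎
    where open ≤-Reasoning

  ∑ˢ-insertAt-false : ∀ k (i : Fin (suc k)) w → (∀ t → w (insertAt t i true) ≡ 0) →
                      ∑ˢ (suc k) w ≡ ∑ˢ k (λ t → w (insertAt t i false))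
  ∑ˢ-insertAt-false k i w w≡0 =
    trans (∑ˢ-insertAt k i w) (cong (_+ ∑ˢ k (λ t → w (insertAt t i false))) (trans (∑ˢ-cong k w≡0) (∑ˢ-zero k)))

  ∑ˢ-insertAt-true : ∀ k (i : Fin (suc k)) w → (∀ t → w (insertAt t i false) ≡ 0) →
                     ∑ˢ (suc k) w ≡ ∑ˢ k (λ t → w (insertAt t i true))
  ∑ˢ-insertAt-true k i w w≡0 =
    trans (∑ˢ-insertAt k i w) (trans (cong (∑ˢ k (λ t → w (insertAt t i true)) +_) (trans (∑ˢ-cong k w≡0) (∑ˢ-zero k)))
      (+-identityʳ _))

  ∣insertAt-true∣ : ∀ {k} (t : Subset k) i → ∣ insertAt t i true ∣ ≡ suc ∣ t ∣
  ∣insertAt-true∣ t           zero    = refl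
  ∣insertAt-true∣ (true ∷ t)  (suc i) = cong suc (∣insertAt-true∣ t i)
  ∣insertAt-true∣ (false ∷ t) (suc i) = ∣insertAt-true∣ t i

  ∣insertAt-false∣ : ∀ {k} (t : Subset k) i → ∣ insertAt t i false ∣ ≡ ∣ t ∣
  ∣insertAt-false∣ t           zero    = refl
  ∣insertAt-false∣ (true ∷ t)  (suc i) = cong suc (∣insertAt-false∣ t i)
  ∣insertAt-false∣ (false ∷ t) (suc i) = ∣insertAt-false∣ t i

  ∣[]≔true∣ : ∀ {n} (s : Subset n) i → lookup s i ≡ false → ∣ s [ i ]≔ true ∣ ≡ suc ∣ s ∣
  ∣[]≔true∣ (false ∷ s) zero    _  = refl
  ∣[]≔true∣ (true ∷ s)  (suc i) eq = cong suc (∣[]≔true∣ s i eq)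
  ∣[]≔true∣ (false ∷ s) (suc i) eq = ∣[]≔true∣ s i eq

  insertAt-[]≔ : ∀ {A : Set} {k} (t : Vec A k) i (v w : A) → insertAt t i v [ i ]≔ w ≡ insertAt t i w
  insertAt-[]≔ t       zero    v w = refl
  insertAt-[]≔ (x ∷ t) (suc i) v w = cong (x ∷_) (insertAt-[]≔ t i v w)

  insertAt-punchIn-[]≔ : ∀ {A : Set} {k} (t : Vec A k) i j (v w : A) →
                         insertAt t i v [ punchIn i j ]≔ w ≡ insertAt (t [ j ]≔ w) i v
  insertAt-punchIn-[]≔ t       zero    j       v w = refl
  insertAt-punchIn-[]≔ (x ∷ t) (suc i) zero    v w = refl
  insertAt-punchIn-[]≔ (x ∷ t) (suc i) (suc j) v w = cong (x ∷_) (insertAt-punchIn-[]≔ t i j v w)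

  ∑-lookup-∧ : ∀ {n} (s : Subset n) b → ∑[ a < n ] 𝟙 (lookup s a ∧ b) ≡ ∣ s ∣ * 𝟙 b
  ∑-lookup-∧ []          b = refl
  ∑-lookup-∧ (true ∷ s)  b = cong (𝟙 b +_) (∑-lookup-∧ s b)
  ∑-lookup-∧ (false ∷ s) b = ∑-lookup-∧ s b

  numEdges≡∑ˢ : ∀ {r n} (G : RGraph r n) → numEdges G ≡ ∑ˢ n (𝟙 ∘ edge G)
  numEdges≡∑ˢ {n = n} G = sumˡ-map-allSubsets n (𝟙 ∘ edge G)

  -- Degrees and codegrees

  extends : ∀ {n} → (Subset n → Bool) → Fin n → Subset n → Bool
  extends e a s = not (lookup s a) ∧ e (s [ a ]≔ true)

  extends-insertAt-true : ∀ {k} e (a : Fin (suc k)) t → extends e a (insertAt t a true) ≡ false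
  extends-insertAt-true e a t rewrite insertAt-lookup t a true = refl

  extends-insertAt-false : ∀ {k} e (a : Fin (suc k)) t → extends e a (insertAt t a false) ≡ e (insertAt t a true)
  extends-insertAt-false e a t rewrite insertAt-lookup t a false | insertAt-[]≔ t a false true = refl

  extends-punchIn : ∀ {k} e (a : Fin (suc k)) b t x →
                    extends e (punchIn a b) (insertAt t a x) ≡ extends (λ u → e (insertAt u a x)) b t
  extends-punchIn e a b t x rewrite insertAt-punchIn t a x b | insertAt-punchIn-[]≔ t a b x true = refl

  degree : ∀ {k} → (Subset (suc k) → Bool) → Fin (suc k) → ℕ
  degree {k} e a = ∑ˢ k (λ t → 𝟙 (e (insertAt t a true)))

  ∑ˢ-extends : ∀ {k} e (a : Fin (suc k)) → ∑ˢ (suc k) (𝟙 ∘ extends e a) ≡ degree e a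
  ∑ˢ-extends {k} e a = trans (∑ˢ-insertAt-false k a (𝟙 ∘ extends e a) (λ t → cong 𝟙 (extends-insertAt-true e a t)))
                             (∑ˢ-cong k (λ t → cong 𝟙 (extends-insertAt-false e a t)))

  ∑ˢ-∋ : ∀ {k} e (a : Fin (suc k)) → ∑ˢ (suc k) (λ s → 𝟙 (lookup s a ∧ e s)) ≡ degree e a
  ∑ˢ-∋ {k} e a =
    trans (∑ˢ-insertAt-true k a (λ s → 𝟙 (lookup s a ∧ e s))
             (λ t → cong (λ x → 𝟙 (x ∧ e (insertAt t a false))) (insertAt-lookup t a false)))
          (∑ˢ-cong k (λ t → cong (λ x → 𝟙 (x ∧ e (insertAt t a true))) (insertAt-lookup t a true)))

  ∣s∣*𝟙edge : ∀ {r n} (G : RGraph r n) s → ∣ s ∣ * 𝟙 (edge G s) ≡ r * 𝟙 (edge G s)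
  ∣s∣*𝟙edge {r} G s with edge G s in eq
  ... | true  = cong (_* 1) (uniform G s eq)
  ... | false = trans (*-zeroʳ ∣ s ∣) (sym (*-zeroʳ r))

  handshake : ∀ {r k} (G : RGraph r (suc k)) → ∑[ a < suc k ] degree (edge G) a ≡ r * numEdges G
  handshake {r} {k} G = begin
    ∑[ a < n ] degree (edge G) a                        ≡⟨ sum-cong-≗ (λ a → sym (∑ˢ-∋ (edge G) a)) ⟩
    ∑[ a < n ] ∑ˢ n (λ s → 𝟙 (lookup s a ∧ edge G s))   ≡⟨ sym (∑ˢ-∑-comm n (λ a s → 𝟙 (lookup s a ∧ edge G s))) ⟩
    ∑ˢ n (λ s → ∑[ a < n ] 𝟙 (lookup s a ∧ edge G s))   ≡⟨ ∑ˢ-cong n (λ s → trans (∑-lookup-∧ s (edge G s)) (∣s∣*𝟙edge G s)) ⟩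
    ∑ˢ n (λ s → r * 𝟙 (edge G s))                       ≡⟨ sym (*-distribˡ-∑ˢ n r (𝟙 ∘ edge G)) ⟩
    r * ∑ˢ n (𝟙 ∘ edge G)                               ≡⟨ cong (r *_) (sym (numEdges≡∑ˢ G)) ⟩
    r * numEdges G                                      ∎
    where
    open ≡-Reasoning
    n = suc k

  codegree : ∀ {n} → (Subset n → Bool) → Subset n → ℕ
  codegree {n} e s = ∑[ a < n ] 𝟙 (extends e a s)

  ∑ˢ-codegree : ∀ {r k} (G : RGraph r (suc k)) → ∑ˢ (suc k) (codegree (edge G)) ≡ r * numEdges G
  ∑ˢ-codegree {k = k} G = trans (∑ˢ-∑-comm (suc k) (λ a → 𝟙 ∘ extends (edge G) a))
    (trans (sum-cong-≗ (∑ˢ-extends (edge G))) (handshake G))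

  codegree-size : ∀ {r n} (G : RGraph (suc r) n) s → codegree (edge G) s ≡ 𝟙 (∣ s ∣ ≡ᵇ r) * codegree (edge G) s
  codegree-size {r} {n} G s =
    trans (sum-cong-≗ extends-size) (sym (*-distribˡ-sum (𝟙 (∣ s ∣ ≡ᵇ r)) (λ a → 𝟙 (extends (edge G) a s))))
    where
    extends-size : ∀ a → 𝟙 (extends (edge G) a s) ≡ 𝟙 (∣ s ∣ ≡ᵇ r) * 𝟙 (extends (edge G) a s)
    extends-size a with lookup s a in a∉s | edge G (s [ a ]≔ true) in e
    ... | true  | _     = sym (*-zeroʳ (𝟙 (∣ s ∣ ≡ᵇ r)))
    ... | false | false = sym (*-zeroʳ (𝟙 (∣ s ∣ ≡ᵇ r)))
    ... | false | true  rewrite suc-injective (trans (sym (∣[]≔true∣ s a a∉s)) (uniform G _ e))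
                              | Equivalence.to T-≡ (≡⇒≡ᵇ r r refl) = refl

  commonLink : ∀ {n} → (Subset n → Bool) → Fin n → Fin n → ℕ
  commonLink {n} e a b = ∑ˢ n (λ s → 𝟙 (extends e a s ∧ extends e b s))

  ∑ˢ-codegree² : ∀ {n} e → ∑ˢ n (λ s → codegree e s * codegree e s) ≡ ∑[ a < n ] ∑[ b < n ] commonLink e a b
  ∑ˢ-codegree² {n} e = begin
    ∑ˢ n (λ s → codegree e s * codegree e s)
      ≡⟨ ∑ˢ-cong n square ⟩
    ∑ˢ n (λ s → ∑[ a < n ] ∑[ b < n ] 𝟙 (extends e a s ∧ extends e b s))
      ≡⟨ ∑ˢ-∑-comm n (λ a s → ∑[ b < n ] 𝟙 (extends e a s ∧ extends e b s)) ⟩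
    ∑[ a < n ] ∑ˢ n (λ s → ∑[ b < n ] 𝟙 (extends e a s ∧ extends e b s))
      ≡⟨ sum-cong-≗ (λ a → ∑ˢ-∑-comm n (λ b s → 𝟙 (extends e a s ∧ extends e b s))) ⟩
    ∑[ a < n ] ∑[ b < n ] commonLink e a b ∎
    where
    open ≡-Reasoning
    square : ∀ s → codegree e s * codegree e s ≡ ∑[ a < n ] ∑[ b < n ] 𝟙 (extends e a s ∧ extends e b s)
    square s = trans (*-distribʳ-sum (codegree e s) (λ a → 𝟙 (extends e a s))) (sum-cong-≗ λ a →
      trans (*-distribˡ-sum (𝟙 (extends e a s)) (λ b → 𝟙 (extends e b s)))
            (sum-cong-≗ λ b → sym (𝟙-∧ (extends e a s) (extends e b s))))

  commonLink-self : ∀ {n} e (a : Fin n) → commonLink e a a ≡ ∑ˢ n (𝟙 ∘ extends e a)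
  commonLink-self {n} e a = ∑ˢ-cong n (λ s → cong 𝟙 (∧-idem (extends e a s)))

  commonLink-punchIn : ∀ {k} e (a : Fin (suc (suc k))) b → commonLink e a (punchIn a b) ≡
    ∑ˢ k (λ u → 𝟙 (e (insertAt (insertAt u b false) a true) ∧ e (insertAt (insertAt u b true) a false)))
  commonLink-punchIn {k} e a b = begin
    ∑ˢ (suc (suc k)) (λ s → 𝟙 (extends e a s ∧ extends e (punchIn a b) s))
      ≡⟨ ∑ˢ-insertAt-false (suc k) a (λ s → 𝟙 (extends e a s ∧ extends e (punchIn a b) s))
           (λ t → cong (λ x → 𝟙 (x ∧ extends e (punchIn a b) (insertAt t a true))) (extends-insertAt-true e a t)) ⟩
    ∑ˢ (suc k) (λ t → 𝟙 (extends e a (insertAt t a false) ∧ extends e (punchIn a b) (insertAt t a false)))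
      ≡⟨ ∑ˢ-cong (suc k) (λ t → cong₂ (λ x y → 𝟙 (x ∧ y)) (extends-insertAt-false e a t) (extends-punchIn e a b t false)) ⟩
    ∑ˢ (suc k) (λ t → 𝟙 (e (insertAt t a true) ∧ extends eₐ b t))
      ≡⟨ ∑ˢ-insertAt-false k b (λ t → 𝟙 (e (insertAt t a true) ∧ extends eₐ b t))
           (λ u → cong (λ y → 𝟙 (e (insertAt (insertAt u b true) a true) ∧ y)) (extends-insertAt-true eₐ b u)
                  ⟨ trans ⟩ cong 𝟙 (∧-zeroʳ _)) ⟩
    ∑ˢ k (λ u → 𝟙 (e (insertAt (insertAt u b false) a true) ∧ extends eₐ b (insertAt u b false)))
      ≡⟨ ∑ˢ-cong k (λ u → cong (λ y → 𝟙 (e (insertAt (insertAt u b false) a true) ∧ y)) (extends-insertAt-false eₐ b u)) ⟩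
    ∑ˢ k (λ u → 𝟙 (e (insertAt (insertAt u b false) a true) ∧ e (insertAt (insertAt u b true) a false))) ∎
    where
    open ≡-Reasoning
    eₐ : Subset (suc k) → Bool
    eₐ u = e (insertAt u a false)

  -- Embedding the two-lift

  ∈-image⁺ : ∀ {m n} (φ : Fin m → Fin n) {s i} → i ∈ s → φ i ∈ image φ s
  ∈-image⁺ φ {s} {i} i∈s = lookup⇒[]= (φ i) _
    (trans (lookup∘tabulate _ (φ i)) (dec-true (any? (λ u → (u ∈? s) ×-dec (φ u ≟ φ i))) (i , i∈s , refl)))

  ∈-image⁻ : ∀ {m n} (φ : Fin m → Fin n) {s j} → j ∈ image φ s → ∃ λ i → i ∈ s × φ i ≡ j
  ∈-image⁻ φ {s} {j} j∈ with any? (λ u → (u ∈? s) ×-dec (φ u ≟ j)) | trans (sym (lookup∘tabulate _ j)) ([]=⇒lookup j∈)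
  ... | yes preimage | _  = preimage
  ... | no _         | ()

  extendAt : ∀ {m k} → Fin (suc k) → (Fin m → Fin k) → Fin (suc m) → Fin (suc k)
  extendAt i φ zero    = i
  extendAt i φ (suc u) = punchIn i (φ u)

  extendAt-injective : ∀ {m k} (i : Fin (suc k)) {φ : Fin m → Fin k} →
                       Injective _≡_ _≡_ φ → Injective _≡_ _≡_ (extendAt i φ)
  extendAt-injective i inj {zero}  {zero}  _  = refl
  extendAt-injective i inj {zero}  {suc v} eq = contradiction (sym eq) (punchInᵢ≢i i _)
  extendAt-injective i inj {suc u} {zero}  eq = contradiction eq (punchInᵢ≢i i _)
  extendAt-injective i inj {suc u} {suc v} eq = cong suc (inj (punchIn-injective i _ _ eq))

  image-extendAt : ∀ {m k} (i : Fin (suc k)) (φ : Fin m → Fin k) x t →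
                   image (extendAt i φ) (x ∷ t) ≡ insertAt (image φ t) i x
  image-extendAt i φ x t = ⊆-antisym ⊆ ⊇
    where
    ⊆ : ∀ {j} → j ∈ image (extendAt i φ) (x ∷ t) → j ∈ insertAt (image φ t) i x
    ⊆ j∈ with ∈-image⁻ (extendAt i φ) j∈
    ... | zero  , here      , refl = lookup⇒[]= i _ (insertAt-lookup _ i true)
    ... | suc u , there u∈t , refl =
      lookup⇒[]= _ _ (trans (insertAt-punchIn _ i x (φ u)) ([]=⇒lookup (∈-image⁺ φ u∈t)))
    ⊇ : ∀ {j} → j ∈ insertAt (image φ t) i x → j ∈ image (extendAt i φ) (x ∷ t)
    ⊇ {j} j∈ with i ≟ j
    ... | yes refl rewrite trans (sym (insertAt-lookup (image φ t) i x)) ([]=⇒lookup j∈) =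
      ∈-image⁺ (extendAt i φ) here
    ... | no i≢j with ∈-image⁻ φ (lookup⇒[]= (punchOut i≢j) _
                       (trans (sym (insertAt-punchIn (image φ t) i x (punchOut i≢j)))
                              (trans (cong (lookup (insertAt (image φ t) i x)) (punchIn-punchOut i≢j)) ([]=⇒lookup j∈))))
    ...   | u , u∈t , φu≡j′ = subst (_∈ image (extendAt i φ) (x ∷ t))
                                (trans (cong (punchIn i) φu≡j′) (punchIn-punchOut i≢j)) (∈-image⁺ (extendAt i φ) (there u∈t))

  -- The edges of the common link graph of a and b′ = punchIn a b are the pairs u, in the vertex set
  -- without a and b′, such that both u ∪ {a} and u ∪ {b′} are edges of G.
  commonLinkGraph : ∀ {k} (G : RGraph 3 (suc (suc k))) → Fin (suc (suc k)) → Fin (suc k) → RGraph 2 k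
  commonLinkGraph G a b = record { edge = linkEdge ; uniform = linkUniform }
    where
    linkEdge : Subset _ → Bool
    linkEdge u = edge G (insertAt (insertAt u b false) a true) ∧ edge G (insertAt (insertAt u b true) a false)
    linkUniform : ∀ u → linkEdge u ≡ true → ∣ u ∣ ≡ 2
    linkUniform u e = suc-injective (begin
      suc ∣ u ∣                                        ≡⟨ cong suc (∣insertAt-false∣ u b) ⟨
      suc ∣ insertAt u b false ∣                       ≡⟨ ∣insertAt-true∣ (insertAt u b false) a ⟨
      ∣ insertAt (insertAt u b false) a true ∣         ≡⟨ uniform G _ (∧-conicalˡ _ _ e) ⟩
      3                                                ∎)
      where open ≡-Reasoning

  numEdges-commonLinkGraph : ∀ {k} (G : RGraph 3 (suc (suc k))) a b →
                             numEdges (commonLinkGraph G a b) ≡ commonLink (edge G) a (punchIn a b)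
  numEdges-commonLinkGraph G a b = trans (numEdges≡∑ˢ (commonLinkGraph G a b)) (sym (commonLink-punchIn (edge G) a b))

  commonLinkGraph-⊇H⇒⊇twoLift : ∀ {k m} (G : RGraph 3 (suc (suc k))) a b (H : RGraph 2 m) →
                                Contains (commonLinkGraph G a b) H → Contains G (twoLift H)
  commonLinkGraph-⊇H⇒⊇twoLift G a b H (φ , φ-inj , φ-hom) =
    ψ , extendAt-injective a (extendAt-injective b φ-inj) , ψ-hom
    where
    ψ = extendAt a (extendAt b φ)
    image-ψ : ∀ x y t → image ψ (x ∷ y ∷ t) ≡ insertAt (insertAt (image φ t) b y) a x
    image-ψ x y t = trans (image-extendAt a (extendAt b φ) x (y ∷ t)) (cong (λ v → insertAt v a x) (image-extendAt b φ y t))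
    ψ-hom : ∀ s → edge (twoLift H) s ≡ true → edge G (image ψ s) ≡ true
    ψ-hom (true ∷ false ∷ t) e rewrite image-ψ true false t = ∧-conicalˡ _ _ (φ-hom t e)
    ψ-hom (false ∷ true ∷ t) e rewrite image-ψ false true t = ∧-conicalʳ _ _ (φ-hom t e)

  -- The counting argument

  maximum : ∀ {n} → (Fin n → ℕ) → ℕ
  maximum {zero}  f = 0
  maximum {suc n} f = f zero ⊔ maximum (f ∘ suc)

  ≤-maximum : ∀ {n} (f : Fin n → ℕ) i → f i ≤ maximum f
  ≤-maximum f zero    = m≤m⊔n _ _
  ≤-maximum f (suc i) = ≤-trans (≤-maximum (f ∘ suc) i) (m≤n⊔m _ _)

  maximum-closed : ∀ (P : ℕ → Set) {n} (f : Fin n → ℕ) → P 0 → (∀ i → P (f i)) → P (maximum f)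
  maximum-closed P {zero}  f P0 Pf = P0
  maximum-closed P {suc n} f P0 Pf with ⊔-sel (f zero) (maximum (f ∘ suc))
  ... | inj₁ eq = subst P (sym eq) (Pf zero)
  ... | inj₂ eq = subst P (sym eq) (maximum-closed P (f ∘ suc) P0 (Pf ∘ suc))

  sum-mono-≤ : ∀ {n} {f g : Fin n → ℕ} → (∀ i → f i ≤ g i) → ∑[ i < n ] f i ≤ ∑[ i < n ] g i
  sum-mono-≤ {zero}  f≤g = z≤n
  sum-mono-≤ {suc n} f≤g = +-mono-≤ (f≤g zero) (sum-mono-≤ (f≤g ∘ suc))

  ∑-const : ∀ n c → ∑[ i < n ] c ≡ n * c
  ∑-const zero    c = refl
  ∑-const (suc n) c = cong (c +_) (∑-const n c)

  maxCommonLink : ∀ {k} → (Subset (suc k) → Bool) → ℕ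
  maxCommonLink e = maximum (λ a → maximum (λ b → commonLink e a (punchIn a b)))

  ∑-commonLink-row : ∀ {k} e (a : Fin (suc k)) →
                     ∑[ b < suc k ] commonLink e a b ≤ commonLink e a a + suc k * maxCommonLink e
  ∑-commonLink-row {k} e a = begin
    ∑[ b < suc k ] commonLink e a b
      ≡⟨ sum-remove {i = a} (commonLink e a) ⟩
    commonLink e a a + ∑[ b < k ] commonLink e a (punchIn a b)
      ≤⟨ +-monoʳ-≤ _ (≤-trans (sum-mono-≤ off-diagonal) (≤-reflexive (∑-const k _))) ⟩
    commonLink e a a + k * maxCommonLink e
      ≤⟨ +-monoʳ-≤ _ (*-monoˡ-≤ _ (n≤1+n k)) ⟩
    commonLink e a a + suc k * maxCommonLink e ∎
    where
    open ≤-Reasoning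
    off-diagonal : ∀ b → commonLink e a (punchIn a b) ≤ maxCommonLink e
    off-diagonal b = ≤-trans (≤-maximum _ b) (≤-maximum (λ a → maximum (λ b → commonLink e a (punchIn a b))) a)

  codegree-inequality : ∀ {k} (G : RGraph 3 (suc k)) →
    3 * numEdges G * (3 * numEdges G) ≤ suc k * suc k * (3 * numEdges G + suc k * (suc k * maxCommonLink (edge G)))
  codegree-inequality {k} G = begin
    3 * E * (3 * E)
      ≡⟨ cong₂ _*_ (sym Σd≡3E) (sym Σd≡3E) ⟩
    ∑ˢ n d * ∑ˢ n d
      ≡⟨ cong₂ _*_ (∑ˢ-cong n (codegree-size G)) (∑ˢ-cong n (codegree-size G)) ⟩
    ∑ˢ n (λ s → pair s * d s) * ∑ˢ n (λ s → pair s * d s)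
      ≤⟨ cauchy-schwarz n pair d ⟩
    ∑ˢ n (λ s → pair s * pair s) * ∑ˢ n (λ s → d s * d s)
      ≤⟨ *-mono-≤ #pairs (≤-reflexive (∑ˢ-codegree² (edge G))) ⟩
    n * n * ∑[ a < n ] ∑[ b < n ] commonLink (edge G) a b
      ≤⟨ *-monoʳ-≤ (n * n) (sum-mono-≤ (∑-commonLink-row (edge G))) ⟩
    n * n * ∑[ a < n ] (commonLink (edge G) a a + n * M)
      ≡⟨ cong (n * n *_) (trans (∑-distrib-+ (λ a → commonLink (edge G) a a) (λ _ → n * M))
                                (cong₂ _+_ Σdiagonal≡3E (∑-const n (n * M)))) ⟩
    n * n * (3 * E + n * (n * M)) ∎
    where
    open ≤-Reasoning
    n = suc k
    E = numEdges G
    M = maxCommonLink (edge G)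
    d = codegree (edge G)
    pair : Subset n → ℕ
    pair s = 𝟙 (∣ s ∣ ≡ᵇ 2)
    Σd≡3E : ∑ˢ n d ≡ 3 * E
    Σd≡3E = ∑ˢ-codegree G
    #pairs : ∑ˢ n (λ s → pair s * pair s) ≤ n * n
    #pairs = begin
      ∑ˢ n (λ s → pair s * pair s) ≡⟨ ∑ˢ-cong n (𝟙-idem ∘ (_≡ᵇ 2) ∘ ∣_∣) ⟩
      ∑ˢ n pair                    ≤⟨ ∑ˢ-size≡k-≤-n^k n 2 ⟩
      n * (n * 1)                  ≡⟨ cong (n *_) (*-identityʳ n) ⟩
      n * n                        ∎
    Σdiagonal≡3E : ∑[ a < n ] commonLink (edge G) a a ≡ 3 * E
    Σdiagonal≡3E = trans (sum-cong-≗ (λ a → trans (commonLink-self (edge G) a) (∑ˢ-extends (edge G) a))) (handshake G)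

  0^n≡0 : ∀ n .{{_ : NonZero n}} → 0 ^ n ≡ 0
  0^n≡0 (suc n) = refl

  [m*m]^n≡m^[2*n] : ∀ m n → (m * m) ^ n ≡ m ^ (2 * n)
  [m*m]^n≡m^[2*n] m n = trans (cong (λ x → (m * x) ^ n) (sym (*-identityʳ m))) (^-*-assoc m 2 n)

  numEdges-empty : ∀ {r} (G : RGraph (suc r) 0) → numEdges G ≡ 0
  numEdges-empty G with edge G [] in e
  ... | false = refl
  ... | true  = contradiction (uniform G [] e) λ ()

  square-bound : ∀ E n M → 3 * E * (3 * E) ≤ n * n * (3 * E + n * (n * M)) →
                 E * E ≤ n * n * (n * n) * M ⊎ E ≤ n * n
  square-bound zero    n M _ = inj₂ z≤n
  square-bound E@(suc _) n M ineq with 3 * E ≤? n * (n * M)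
  ... | yes 3E≤n²M = inj₁ (*-cancelˡ-≤ 2 (begin
    2 * (E * E)                          ≤⟨ *-monoˡ-≤ (E * E) (m≤m+n 2 7) ⟩
    9 * (E * E)                          ≡⟨ solve 1 (λ E → con 9 :* (E :* E) := con 3 :* E :* (con 3 :* E)) refl E ⟩
    3 * E * (3 * E)                      ≤⟨ ineq ⟩
    n * n * (3 * E + n * (n * M))        ≤⟨ *-monoʳ-≤ (n * n) (+-monoˡ-≤ _ 3E≤n²M) ⟩
    n * n * (n * (n * M) + n * (n * M))  ≡⟨ solve 2 (λ n M → n :* n :* (n :* (n :* M) :+ n :* (n :* M))
                                                         := con 2 :* (n :* n :* (n :* n) :* M)) refl n M ⟩
    2 * (n * n * (n * n) * M)            ∎))
    where open ≤-Reasoning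
  ... | no 3E≰n²M = inj₂ (*-cancelˡ-≤ 3 (≤-trans 3E≤2n² (*-monoˡ-≤ (n * n) (n≤1+n 2))))
    where
    open ≤-Reasoning
    3E≤2n² : 3 * E ≤ 2 * (n * n)
    3E≤2n² = *-cancelʳ-≤ (3 * E) (2 * (n * n)) (3 * E) (begin
      3 * E * (3 * E)                ≤⟨ ineq ⟩
      n * n * (3 * E + n * (n * M))  ≤⟨ *-monoʳ-≤ (n * n) (+-monoʳ-≤ (3 * E) (<⇒≤ (≰⇒> 3E≰n²M))) ⟩
      n * n * (3 * E + 3 * E)        ≡⟨ solve 2 (λ n x → n :* n :* (x :+ x) := con 2 :* (n :* n) :* x) refl n (3 * E) ⟩
      2 * (n * n) * (3 * E)          ∎)

  module _ {m} (H : RGraph 2 m) (C p q : ℕ) .{{_ : NonZero q}}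
           (ex-H : ∀ k (J : RGraph 2 k) → ¬ Contains J H → numEdges J ^ q ≤ C ^ q * k ^ p) where

    commonLink-bound : ∀ {k} (G : RGraph 3 (suc k)) → ¬ Contains G (twoLift H) → ∀ a b →
                       commonLink (edge G) a (punchIn a b) ^ q ≤ C ^ q * suc k ^ p
    commonLink-bound {zero}  G G-free a ()
    commonLink-bound {suc k} G G-free a b = begin
      commonLink (edge G) a (punchIn a b) ^ q  ≡⟨ cong (_^ q) (numEdges-commonLinkGraph G a b) ⟨
      numEdges (commonLinkGraph G a b) ^ q     ≤⟨ ex-H k (commonLinkGraph G a b) (G-free ∘ commonLinkGraph-⊇H⇒⊇twoLift G a b H) ⟩
      C ^ q * k ^ p                            ≤⟨ *-monoʳ-≤ (C ^ q) (^-monoˡ-≤ p (≤-trans (n≤1+n k) (n≤1+n (suc k)))) ⟩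
      C ^ q * suc (suc k) ^ p                  ∎
      where open ≤-Reasoning

    maxCommonLink-bound : ∀ {k} (G : RGraph 3 (suc k)) → ¬ Contains G (twoLift H) →
                          maxCommonLink (edge G) ^ q ≤ C ^ q * suc k ^ p
    maxCommonLink-bound {k} G G-free =
      maximum-closed Bounded _ bounded-0 (λ a → maximum-closed Bounded _ bounded-0 (commonLink-bound G G-free a))
      where
      Bounded : ℕ → Set
      Bounded x = x ^ q ≤ C ^ q * suc k ^ p
      bounded-0 : Bounded 0
      bounded-0 = ≤-trans (≤-reflexive (0^n≡0 q)) z≤n

    twoLift-free-bound : ∀ n (G : RGraph 3 n) → ¬ Contains G (twoLift H) →
                         numEdges G ^ (2 * q) ≤ suc C ^ (2 * q) * n ^ (p + 4 * q)
    twoLift-free-bound zero G _ rewrite numEdges-empty G = ≤-trans (≤-reflexive (0^n≡0 (2 * q))) z≤n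
      where instance _ = m*n≢0 2 q
    twoLift-free-bound n@(suc k) G G-free = [ dense , sparse ]′ (square-bound E n M (codegree-inequality G))
      where
      open ≤-Reasoning
      E = numEdges G
      M = maxCommonLink (edge G)
      D = suc C
      [n*n]^[2*q]≡n^[4*q] : (n * n) ^ (2 * q) ≡ n ^ (4 * q)
      [n*n]^[2*q]≡n^[4*q] = trans ([m*m]^n≡m^[2*n] n (2 * q)) (cong (n ^_) (sym (*-assoc 2 2 q)))
      dense : E * E ≤ n * n * (n * n) * M → E ^ (2 * q) ≤ D ^ (2 * q) * n ^ (p + 4 * q)
      dense E²≤n⁴M = begin
        E ^ (2 * q)                                    ≡⟨ [m*m]^n≡m^[2*n] E q ⟨
        (E * E) ^ q                                    ≤⟨ ^-monoˡ-≤ q E²≤n⁴M ⟩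
        (n * n * (n * n) * M) ^ q                      ≡⟨ ^-distribʳ-* (n * n * (n * n)) M q ⟩
        (n * n * (n * n)) ^ q * M ^ q                  ≤⟨ *-monoʳ-≤ ((n * n * (n * n)) ^ q) (maxCommonLink-bound G G-free) ⟩
        (n * n * (n * n)) ^ q * (C ^ q * n ^ p)        ≤⟨ *-monoʳ-≤ ((n * n * (n * n)) ^ q) (*-monoˡ-≤ (n ^ p) C^q≤D^2q) ⟩
        (n * n * (n * n)) ^ q * (D ^ (2 * q) * n ^ p)  ≡⟨ cong (_* (D ^ (2 * q) * n ^ p)) n⁴^q≡n^4q ⟩
        n ^ (4 * q) * (D ^ (2 * q) * n ^ p)            ≡⟨ rearrange ⟩
        D ^ (2 * q) * n ^ (p + 4 * q)                  ∎
        where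
        C^q≤D^2q : C ^ q ≤ D ^ (2 * q)
        C^q≤D^2q = ≤-trans (^-monoˡ-≤ q (n≤1+n C)) (^-monoʳ-≤ D (m≤n*m q 2))
        n⁴^q≡n^4q : (n * n * (n * n)) ^ q ≡ n ^ (4 * q)
        n⁴^q≡n^4q = trans ([m*m]^n≡m^[2*n] (n * n) q) [n*n]^[2*q]≡n^[4*q]
        rearrange : n ^ (4 * q) * (D ^ (2 * q) * n ^ p) ≡ D ^ (2 * q) * n ^ (p + 4 * q)
        rearrange = trans (trans (*-comm (n ^ (4 * q)) _) (*-assoc (D ^ (2 * q)) (n ^ p) _))
                          (cong (D ^ (2 * q) *_) (sym (^-distribˡ-+-* n p (4 * q))))
      sparse : E ≤ n * n → E ^ (2 * q) ≤ D ^ (2 * q) * n ^ (p + 4 * q)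
      sparse E≤n² = begin
        E ^ (2 * q)                        ≤⟨ ^-monoˡ-≤ (2 * q) E≤n² ⟩
        (n * n) ^ (2 * q)                  ≡⟨ [n*n]^[2*q]≡n^[4*q] ⟩
        n ^ (4 * q)                        ≤⟨ m≤n*m (n ^ (4 * q)) (D ^ (2 * q) * n ^ p) ⟩
        D ^ (2 * q) * n ^ p * n ^ (4 * q)  ≡⟨ *-assoc (D ^ (2 * q)) _ _ ⟩
        D ^ (2 * q) * (n ^ p * n ^ (4 * q))  ≡⟨ cong (D ^ (2 * q) *_) (^-distribˡ-+-* n p (4 * q)) ⟨
        D ^ (2 * q) * n ^ (p + 4 * q)      ∎
        where instance _ = m*n≢0 (D ^ (2 * q)) (n ^ p) {{m^n≢0 D (2 * q)}} {{m^n≢0 n p}}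

  ^-comm : ∀ m a b → (m ^ a) ^ b ≡ (m ^ b) ^ a
  ^-comm m a b = trans (^-*-assoc m a b) (trans (cong (m ^_) (*-comm a b)) (sym (^-*-assoc m b a)))

  ^-rescale : ∀ {a b n} e k p′ q′ .{{_ : NonZero k}} → a ^ k ≤ b ^ k * n ^ e → p′ * k ≡ e * q′ →
              a ^ q′ ≤ b ^ q′ * n ^ p′
  ^-rescale {a} {b} {n} e k p′ q′ aᵏ≤bᵏnᵉ p′k≡eq′ = ^-cancelʳ-≤ k (begin
    (a ^ q′) ^ k                    ≡⟨ ^-comm a q′ k ⟩
    (a ^ k) ^ q′                    ≤⟨ ^-monoˡ-≤ q′ aᵏ≤bᵏnᵉ ⟩
    (b ^ k * n ^ e) ^ q′            ≡⟨ ^-distribʳ-* (b ^ k) (n ^ e) q′ ⟩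
    (b ^ k) ^ q′ * (n ^ e) ^ q′     ≡⟨ cong₂ _*_ (^-comm b k q′) (trans (^-*-assoc n e q′) (cong (n ^_) (sym p′k≡eq′))) ⟩
    (b ^ q′) ^ k * n ^ (p′ * k)     ≡⟨ cong ((b ^ q′) ^ k *_) (sym (^-*-assoc n p′ k)) ⟩
    (b ^ q′) ^ k * (n ^ p′) ^ k     ≡⟨ ^-distribʳ-* (b ^ q′) (n ^ p′) k ⟨
    (b ^ q′ * n ^ p′) ^ k           ∎)
    where open ≤-Reasoning

  upper-cut-positive : ∀ (γ : PosReal) {r} → U γ r → 0ℚ <ℚ r
  upper-cut-positive γ {r} r∈U with positive γ
  ... | r₀ , 0<r₀ , r₀∉U with r ≤ℚ? r₀
  ...   | yes r≤r₀ = contradiction (upward γ r∈U r≤r₀) r₀∉U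
  ...   | no r≰r₀  = <ℚ-trans 0<r₀ (≰⇒>ℚ r≰r₀)

  ↥↧-[r+4]*½ : ∀ r → 0ℚ <ℚ r →
               ∣ ↥ ((r +ℚ ℤ.+ 4 / 1) *ℚ ½) ∣ℤ * (2 * ↧ₙ r)
               ≡ (∣ ↥ r ∣ℤ + 4 * ↧ₙ r) * ↧ₙ ((r +ℚ ℤ.+ 4 / 1) *ℚ ½)
  ↥↧-[r+4]*½ r@(mkℚ +[1+ x ] d _) _
    with (r +ℚ ℤ.+ 4 / 1) *ℚ ½ | ≃-trans (toℚᵘ-homo-* (r +ℚ ℤ.+ 4 / 1) ½) (*-congʳ (toℚᵘ-homo-+ r (ℤ.+ 4 / 1)))
  -- cross-multiplied equates n′/(1 + d′) with the unnormalised (r + 4)·½ = (1 + x + 4(1 + d))/(2(1 + d)).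
  ... | mkℚ n′ d′ _ | *≡* cross-multiplied = begin
    ∣ n′ ∣ℤ * (2 * suc d)                       ≡⟨ cong (∣ n′ ∣ℤ *_) (solve 1 (λ d → con 2 :* (con 1 :+ d) := con 2 :+ d :* con 1 :* con 2) refl d) ⟩
    ∣ n′ ∣ℤ * suc (suc (d * 1 * 2))             ≡⟨ abs-◃ _ _ ⟨
    ∣ n′ ℤ.* +[1+ suc (d * 1 * 2) ] ∣ℤ          ≡⟨ cong ∣_∣ℤ cross-multiplied ⟩
    suc (d′ + (x * 1 + 4 * suc d) * 1 * suc d′) ≡⟨ solve 3 (λ d′ x d → con 1 :+ (d′ :+ (x :* con 1 :+ con 4 :* (con 1 :+ d)) :* con 1 :* (con 1 :+ d′))
                                                                     := (con 1 :+ x :+ con 4 :* (con 1 :+ d)) :* (con 1 :+ d′)) refl d′ x d ⟩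
    (suc x + 4 * suc d) * suc d′                ∎
    where open ≡-Reasoning
  ↥↧-[r+4]*½ r@(mkℚ +0 _ _) 0<r with ℚ-positive {r} 0<r
  ... | ()
  ↥↧-[r+4]*½ r@(mkℚ -[1+ _ ] _ _) 0<r with ℚ-positive {r} 0<r
  ... | ()

  twoLift-free-bound-at : ∀ {m} (H : RGraph 2 m) C r → 0ℚ <ℚ r →
    (∀ k (J : RGraph 2 k) → ¬ Contains J H → numEdges J ^ ↧ₙ r ≤ C ^ ↧ₙ r * k ^ ∣ ↥ r ∣ℤ) →
    ∀ n (G : RGraph 3 n) → ¬ Contains G (twoLift H) →
    numEdges G ^ ↧ₙ ((r +ℚ ℤ.+ 4 / 1) *ℚ ½)
      ≤ suc C ^ ↧ₙ ((r +ℚ ℤ.+ 4 / 1) *ℚ ½) * n ^ ∣ ↥ ((r +ℚ ℤ.+ 4 / 1) *ℚ ½) ∣ℤ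
  twoLift-free-bound-at H C r 0<r ex-H n G G-free =
    ^-rescale {numEdges G} {suc C} {n} (∣ ↥ r ∣ℤ + 4 * ↧ₙ r) (2 * ↧ₙ r) ∣ ↥ ρ ∣ℤ (↧ₙ ρ)
      (twoLift-free-bound H C ∣ ↥ r ∣ℤ (↧ₙ r) ex-H n G G-free) (↥↧-[r+4]*½ r 0<r)
    where ρ = (r +ℚ ℤ.+ 4 / 1) *ℚ ½

open import Data.Integer using (+_)
open import Data.Nat using (ℕ; suc)
open import Data.Product using (_,_)
open import Data.Rational using (ℚ; _+_; _*_; ½; _/_)
open import Defs
open TwoLiftExtremal using (twoLift-free-bound-at; upper-cut-positive)

lemma4 : ∀ {m} (H : RGraph 2 m) → Bipartite H → (γ : PosReal) →
    ExBigO H γ (λ r → r) →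
    ExBigO (twoLift H) γ (λ r → (r + (+ 4 / 1)) * ½)
lemma4 H _ γ (C , ex-H) = suc C , λ r r∈U → twoLift-free-bound-at H C r (upper-cut-positive γ r∈U) (ex-H r r∈U)
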